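{- Let $q$ be an odd prime power and $\mathbb{F}=\mathbb{F}_q$. For each $(a,b)\in\Sigma$ there exists exactly one $(x,y)\in S$ such that \[ a=\frac{x(1-y)}{x-y},\quad b=\frac{1-y}{x-y},\quad 1-a=\frac{y(1-x)}{y-x},\quad 1-b=\frac{1-x}{y-x}. \] The mapping $\Psi:\Sigma\to S$, $(a,b)\mapsto\bigl(a/b,\,(1-a)/(1-b)\bigr)$ is a bijection, and for $(x,y)\in S$ we have $\Psi^{ -1}((x,y))=(a,b)$ if and only if the four displayed equalities hold.
   Context: A square in $\mathbb{F}$ is an element $z^2$, $z\in\mathbb{F}$. $\Sigma=\Sigma(\mathbb{F})$ is the set of $(a,b)\in\mathbb{F}\times\mathbb{F}$ with $a\ne b$, $a,b\notin\{0,1\}$, and both $ab$ and $(1-a)(1-b)$ squares. $S=S(\mathbb{F})$ is the set of $(x,y)\in\mathbb{F}\times\mathbb{F}$ such that $x$ and $y$ are squares, $x\ne y$, and $\{0,1\}\cap\{x,y\}=\emptyset$. -}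

module Defs where

open import Level using (Level; _⊔_) renaming (suc to lsuc)
open import Algebra.Bundles using (CommutativeRing)
open import Data.Nat using (ℕ; _^_; _≤_)
open import Data.Nat.Primality using (Prime)
open import Data.Fin using (Fin)
open import Data.Product using (Σ; ∃; _×_; _,_; proj₁; proj₂)
open import Relation.Nullary using (¬_)
open import Relation.Binary.PropositionalEquality using (_≡_; _≢_)

OddPrimePower : ℕ → Set
OddPrimePower q = Σ ℕ λ p → Σ ℕ λ k → Prime p × p ≢ 2 × 1 ≤ k × q ≡ p ^ k

-- The inverse is a total function (its value at 0 is unconstrained);
-- only its values at nonzero elements are ever used below.
record FiniteField (c ℓ : Level) : Set (lsuc (c ⊔ ℓ)) where
  field
    commutativeRing : CommutativeRing c ℓ
  open CommutativeRing commutativeRing public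
  field
    1≉0             : ¬ (1# ≈ 0#)
    _⁻¹             : Carrier → Carrier
    inverse         : ∀ x → ¬ (x ≈ 0#) → x * (x ⁻¹) ≈ 1#
    size            : ℕ
    enum            : Fin size → Carrier
    enum-injective  : ∀ i j → enum i ≈ enum j → i ≡ j
    enum-surjective : ∀ x → ∃ λ i → enum i ≈ x

  infixl 7 _/_
  _/_ : Carrier → Carrier → Carrier
  x / y = x * (y ⁻¹)

  IsSquare : Carrier → Set (c ⊔ ℓ)
  IsSquare x = ∃ λ z → z * z ≈ x

  InΣ : Carrier → Carrier → Set (c ⊔ ℓ)
  InΣ a b = ¬ (a ≈ b) × ¬ (a ≈ 0#) × ¬ (a ≈ 1#) × ¬ (b ≈ 0#) × ¬ (b ≈ 1#)
            × IsSquare (a * b) × IsSquare ((1# - a) * (1# - b))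

  InS : Carrier → Carrier → Set (c ⊔ ℓ)
  InS x y = IsSquare x × IsSquare y × ¬ (x ≈ y)
            × ¬ (x ≈ 0#) × ¬ (x ≈ 1#) × ¬ (y ≈ 0#) × ¬ (y ≈ 1#)

  FourEqs : Carrier → Carrier → Carrier → Carrier → Set ℓ
  FourEqs a b x y = (a ≈ (x * (1# - y)) / (x - y))
                  × (b ≈ (1# - y) / (x - y))
                  × ((1# - a) ≈ (y * (1# - x)) / (y - x))
                  × ((1# - b) ≈ (1# - x) / (y - x))

  Ψ : Carrier × Carrier → Carrier × Carrier
  Ψ (a , b) = (a / b , (1# - a) / (1# - b))

  _≈₂_ : Carrier × Carrier → Carrier × Carrier → Set ℓ
  (a , b) ≈₂ (x , y) = (a ≈ x) × (b ≈ y)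

-- Clearing denominators, Ψ (a , b) = (x , y) says a = x b and 1 - a = y (1 - b): a linear
-- system in (a , b) whose determinant is x - y, and Cramer's rule for it is exactly the four
-- displayed equalities. The system is symmetric under (a , b , x , y) ↦ (1 - a , 1 - b , y , x),
-- so every statement about x has a mirror image about y. The conditions defining Σ and S
-- correspond to each other through a = x b, 1 - a = y (1 - b): for instance a b = x b² and
-- (1 - a)(1 - b) = y (1 - b)², and x = y would force 1 = a + (1 - a) = x.
module Submission where

open import Defs
open import Level using (Level)
open import Algebra.Bundles using (CommutativeRing)
open import Data.Maybe using (Maybe; just; nothing)
open import Data.Nat as ℕ using (zero; suc)
import Data.Nat.Properties as ℕ
open import Data.Integer as ℤ using (ℤ; +_; -[1+_]; _⊖_; _◃_)
import Data.Integer.Properties as ℤ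
import Data.Sign as Sign
open import Data.Product using (∃; _×_; _,_; proj₁; proj₂)
open import Function.Base using (_∘_)
open import Function.Bundles using (Equivalence; _⇔_; mk⇔)
open import Relation.Nullary using (yes; no)
import Relation.Binary.PropositionalEquality as ≡
import Algebra.Solver.Ring
open import Algebra.Solver.Ring.AlmostCommutativeRing
  using (fromCommutativeRing; _-Raw-AlmostCommutative⟶_)

-- Coefficients are taken in ℤ rather than in the ring itself because the solver compares
-- normal forms by reduction, so the coefficient arithmetic must compute.
module IntegerCoefficientSolver {c ℓ : Level} (R : CommutativeRing c ℓ) where
  open CommutativeRing R
  open import Algebra.Properties.Ring ring
    using (-‿involutive; -‿+-comm; -0#≈0#; -‿distribˡ-*; -‿distribʳ-*)
  open import Algebra.Properties.Semiring.Mult.TCOptimised semiring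
    using (1+×; ×-homo-+; ×1-homo-*) renaming (_×_ to _·_)
  open import Relation.Binary.Reasoning.Setoid setoid

  fromℤ : ℤ → Carrier
  fromℤ (+ n)    = n · 1#
  fromℤ -[1+ n ] = - (suc n · 1#)

  private
    [1+u]-[1+v]≈u-v : ∀ u v → (1# + u) - (1# + v) ≈ u - v
    [1+u]-[1+v]≈u-v u v = begin
      (1# + u) + - (1# + v)    ≈⟨ +-congˡ (-‿+-comm 1# v) ⟨
      (1# + u) + (- 1# + - v)  ≈⟨ +-assoc 1# u _ ⟩
      1# + (u + (- 1# + - v))  ≈⟨ +-congˡ (+-assoc u (- 1#) (- v)) ⟨
      1# + ((u + - 1#) + - v)  ≈⟨ +-congˡ (+-congʳ (+-comm u (- 1#))) ⟩
      1# + ((- 1# + u) + - v)  ≈⟨ +-congˡ (+-assoc (- 1#) u (- v)) ⟩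
      1# + (- 1# + (u - v))    ≈⟨ +-assoc 1# (- 1#) _ ⟨
      (1# + - 1#) + (u - v)    ≈⟨ +-congʳ (-‿inverseʳ 1#) ⟩
      0# + (u - v)             ≈⟨ +-identityˡ _ ⟩
      u - v                    ∎

    fromℤ-⊖ : ∀ m n → fromℤ (m ⊖ n) ≈ m · 1# - n · 1#
    fromℤ-⊖ m       zero    = sym (trans (+-congˡ -0#≈0#) (+-identityʳ _))
    fromℤ-⊖ zero    (suc n) = sym (+-identityˡ _)
    fromℤ-⊖ (suc m) (suc n) = begin
      fromℤ (suc m ⊖ suc n)          ≡⟨ ≡.cong fromℤ (ℤ.[1+m]⊖[1+n]≡m⊖n m n) ⟩
      fromℤ (m ⊖ n)                  ≈⟨ fromℤ-⊖ m n ⟩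
      m · 1# - n · 1#                ≈⟨ [1+u]-[1+v]≈u-v _ _ ⟨
      (1# + m · 1#) - (1# + n · 1#)  ≈⟨ +-cong (1+× m 1#) (-‿cong (1+× n 1#)) ⟨
      suc m · 1# - suc n · 1#        ∎

    fromℤ-+◃ : ∀ n → fromℤ (Sign.+ ◃ n) ≈ n · 1#
    fromℤ-+◃ zero    = refl
    fromℤ-+◃ (suc n) = refl

    fromℤ--◃ : ∀ n → fromℤ (Sign.- ◃ n) ≈ - (n · 1#)
    fromℤ--◃ zero    = sym -0#≈0#
    fromℤ--◃ (suc n) = refl

    fromℤ-homo-+ : ∀ i j → fromℤ (i ℤ.+ j) ≈ fromℤ i + fromℤ j
    fromℤ-homo-+ (+ m)    (+ n)    = ×-homo-+ 1# m n
    fromℤ-homo-+ (+ m)    -[1+ n ] = fromℤ-⊖ m (suc n)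
    fromℤ-homo-+ -[1+ m ] (+ n)    = trans (fromℤ-⊖ n (suc m)) (+-comm _ _)
    fromℤ-homo-+ -[1+ m ] -[1+ n ] = begin
      - (suc (suc m ℕ.+ n) · 1#)       ≡⟨ ≡.cong (λ k → - (k · 1#)) (ℕ.+-suc (suc m) n) ⟨
      - ((suc m ℕ.+ suc n) · 1#)       ≈⟨ -‿cong (×-homo-+ 1# (suc m) (suc n)) ⟩
      - (suc m · 1# + suc n · 1#)      ≈⟨ -‿+-comm _ _ ⟨
      - (suc m · 1#) + - (suc n · 1#)  ∎

    fromℤ-homo-* : ∀ i j → fromℤ (i ℤ.* j) ≈ fromℤ i * fromℤ j
    fromℤ-homo-* (+ m)    (+ n)    = trans (fromℤ-+◃ (m ℕ.* n)) (×1-homo-* m n)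
    fromℤ-homo-* (+ m)    -[1+ n ] = begin
      fromℤ (Sign.- ◃ (m ℕ.* suc n))  ≈⟨ fromℤ--◃ (m ℕ.* suc n) ⟩
      - ((m ℕ.* suc n) · 1#)          ≈⟨ -‿cong (×1-homo-* m (suc n)) ⟩
      - (m · 1# * suc n · 1#)         ≈⟨ -‿distribʳ-* _ _ ⟩
      m · 1# * - (suc n · 1#)         ∎
    fromℤ-homo-* -[1+ m ] (+ n)    = begin
      fromℤ (Sign.- ◃ (suc m ℕ.* n))  ≈⟨ fromℤ--◃ (suc m ℕ.* n) ⟩
      - ((suc m ℕ.* n) · 1#)          ≈⟨ -‿cong (×1-homo-* (suc m) n) ⟩
      - (suc m · 1# * n · 1#)         ≈⟨ -‿distribˡ-* _ _ ⟩
      - (suc m · 1#) * n · 1#         ∎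
    fromℤ-homo-* -[1+ m ] -[1+ n ] = begin
      fromℤ (Sign.+ ◃ (suc m ℕ.* suc n))  ≈⟨ fromℤ-+◃ (suc m ℕ.* suc n) ⟩
      (suc m ℕ.* suc n) · 1#              ≈⟨ ×1-homo-* (suc m) (suc n) ⟩
      suc m · 1# * suc n · 1#             ≈⟨ -‿involutive _ ⟨
      - - (suc m · 1# * suc n · 1#)       ≈⟨ -‿cong (-‿distribˡ-* _ _) ⟩
      - (- (suc m · 1#) * suc n · 1#)     ≈⟨ -‿distribʳ-* _ _ ⟩
      - (suc m · 1#) * - (suc n · 1#)     ∎

    fromℤ-homo-‿ : ∀ i → fromℤ (ℤ.- i) ≈ - fromℤ i
    fromℤ-homo-‿ (+ zero)  = sym -0#≈0#
    fromℤ-homo-‿ (+ suc n) = refl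
    fromℤ-homo-‿ -[1+ n ]  = sym (-‿involutive _)

  homomorphism : ℤ.+-*-rawRing -Raw-AlmostCommutative⟶ fromCommutativeRing R
  homomorphism = record
    { ⟦_⟧    = fromℤ
    ; +-homo = fromℤ-homo-+
    ; *-homo = fromℤ-homo-*
    ; -‿homo = fromℤ-homo-‿
    ; 0-homo = refl
    ; 1-homo = refl
    }

  fromℤ-≟ : ∀ i j → Maybe (fromℤ i ≈ fromℤ j)
  fromℤ-≟ i j with i ℤ.≟ j
  ... | yes ≡.refl = just refl
  ... | no _       = nothing

  open Algebra.Solver.Ring ℤ.+-*-rawRing (fromCommutativeRing R) homomorphism fromℤ-≟ public

module _ {c ℓ : Level} (F : FiniteField c ℓ) where
  open FiniteField F
  open IntegerCoefficientSolver commutativeRing using (solve; _:=_; _:+_; _:-_; _:*_; con)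
  open import Algebra.Properties.Ring ring
    using (x∙y⁻¹≈ε⇒x≈y; x≈y⇒x∙y⁻¹≈ε; +-cancelˡ; -‿injective)
  open import Relation.Binary.Properties.Setoid setoid using (≉-sym)
  open import Relation.Binary.Reasoning.Setoid setoid

  private variable
    a b a′ b′ p q r t x y : Carrier

  *≈⇒≈/ : q ≉ 0# → x * q ≈ p → x ≈ p / q
  *≈⇒≈/ {q} {x} {p} q≉0 xq≈p = begin
    x               ≈⟨ *-identityʳ x ⟨
    x * 1#          ≈⟨ *-congˡ (inverse q q≉0) ⟨
    x * (q * q ⁻¹)  ≈⟨ *-assoc x q (q ⁻¹) ⟨
    (x * q) * q ⁻¹  ≈⟨ *-congʳ xq≈p ⟩
    p / q           ∎

  ≈/⇒*≈ : q ≉ 0# → x ≈ p / q → x * q ≈ p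
  ≈/⇒*≈ {q} {x} {p} q≉0 x≈p/q = begin
    x * q           ≈⟨ *-congʳ x≈p/q ⟩
    (p * q ⁻¹) * q  ≈⟨ *-assoc p (q ⁻¹) q ⟩
    p * (q ⁻¹ * q)  ≈⟨ *-congˡ (*-comm (q ⁻¹) q) ⟩
    p * (q * q ⁻¹)  ≈⟨ *-congˡ (inverse q q≉0) ⟩
    p * 1#          ≈⟨ *-identityʳ p ⟩
    p               ∎

  /≈⇔≈* : q ≉ 0# → (p / q ≈ x) ⇔ (p ≈ x * q)
  /≈⇔≈* q≉0 = mk⇔ (λ p/q≈x → sym (≈/⇒*≈ q≉0 (sym p/q≈x)))
                  (λ p≈xq → sym (*≈⇒≈/ q≉0 (sym p≈xq)))

  *-≉0 : x ≉ 0# → y ≉ 0# → x * y ≉ 0#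
  *-≉0 {x} {y} x≉0 y≉0 xy≈0 = x≉0 (trans (*≈⇒≈/ y≉0 xy≈0) (zeroˡ (y ⁻¹)))

  factor≉0 : r ≈ p * q → r ≉ 0# → p ≉ 0#
  factor≉0 {r} {p} {q} r≈pq r≉0 p≈0 = r≉0 (begin
    r       ≈⟨ r≈pq ⟩
    p * q   ≈⟨ *-congʳ p≈0 ⟩
    0# * q  ≈⟨ zeroˡ q ⟩
    0#      ∎)

  factor≉1 : r ≈ p * q → r ≉ q → p ≉ 1#
  factor≉1 {r} {p} {q} r≈pq r≉q p≈1 = r≉q (begin
    r       ≈⟨ r≈pq ⟩
    p * q   ≈⟨ *-congʳ p≈1 ⟩
    1# * q  ≈⟨ *-identityˡ q ⟩
    q       ∎)

  -≉0 : x ≉ y → x - y ≉ 0#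
  -≉0 {x} {y} x≉y = x≉y ∘ x∙y⁻¹≈ε⇒x≈y x y

  1-‿injective : 1# - x ≈ 1# - y → x ≈ y
  1-‿injective = -‿injective ∘ +-cancelˡ 1# _ _

  1-[1-t]≈t : ∀ t → 1# - (1# - t) ≈ t
  1-[1-t]≈t = solve 1 (λ t → con (+ 1) :- (con (+ 1) :- t) := t) refl

  t+[1-t]≈1 : ∀ t → t + (1# - t) ≈ 1#
  t+[1-t]≈1 = solve 1 (λ t → t :+ (con (+ 1) :- t) := con (+ 1)) refl

  IsSquare-resp : x ≈ y → IsSquare x → IsSquare y
  IsSquare-resp x≈y (z , z²≈x) = z , trans z²≈x x≈y

  IsSquare-*-square : IsSquare x → IsSquare (x * (t * t))
  IsSquare-*-square {x} {t} (z , z²≈x) = z * t , (begin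
    (z * t) * (z * t)  ≈⟨ interchange z t ⟩
    (z * z) * (t * t)  ≈⟨ *-congʳ z²≈x ⟩
    x * (t * t)        ∎)
    where
    interchange : ∀ z t → (z * t) * (z * t) ≈ (z * z) * (t * t)
    interchange = solve 2 (λ z t → (z :* t) :* (z :* t) := (z :* z) :* (t :* t)) refl

  IsSquare-/ : q ≉ 0# → IsSquare (p * q) → IsSquare (p / q)
  IsSquare-/ {q} {p} q≉0 = IsSquare-resp pq[q⁻¹q⁻¹]≈p/q ∘ IsSquare-*-square
    where
    interchange : ∀ p q w → (p * q) * (w * w) ≈ (p * w) * (q * w)
    interchange = solve 3 (λ p q w → (p :* q) :* (w :* w) := (p :* w) :* (q :* w)) refl

    pq[q⁻¹q⁻¹]≈p/q : (p * q) * (q ⁻¹ * q ⁻¹) ≈ p / q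
    pq[q⁻¹q⁻¹]≈p/q = begin
      (p * q) * (q ⁻¹ * q ⁻¹)  ≈⟨ interchange p q (q ⁻¹) ⟩
      (p / q) * (q * q ⁻¹)     ≈⟨ *-congˡ (inverse q q≉0) ⟩
      (p / q) * 1#             ≈⟨ *-identityʳ _ ⟩
      p / q                    ∎

  ΨEqs : Carrier → Carrier → Carrier → Carrier → Set ℓ
  ΨEqs a b x y = (a ≈ x * b) × (1# - a ≈ y * (1# - b))

  Ψ≈₂⇔ΨEqs : InΣ a b → Ψ (a , b) ≈₂ (x , y) ⇔ ΨEqs a b x y
  Ψ≈₂⇔ΨEqs {a} {b} {x} {y} (_ , _ , _ , b≉0 , b≉1 , _) = mk⇔
    (λ (ex , ey) → to x-eq ex , to y-eq ey)
    (λ (ex , ey) → from x-eq ex , from y-eq ey)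
    where
    open Equivalence
    x-eq : (a / b ≈ x) ⇔ (a ≈ x * b)
    x-eq = /≈⇔≈* b≉0
    y-eq : ((1# - a) / (1# - b) ≈ y) ⇔ (1# - a ≈ y * (1# - b))
    y-eq = /≈⇔≈* (-≉0 (≉-sym b≉1))

  ΨEqs-swap : ΨEqs a b x y → ΨEqs (1# - a) (1# - b) y x
  ΨEqs-swap {a} {b} (a≈xb , 1-a≈y[1-b]) =
    1-a≈y[1-b] , trans (1-[1-t]≈t a) (trans a≈xb (*-congˡ (sym (1-[1-t]≈t b))))

  ΨEqs-diagonal : ΨEqs a b x x → x ≈ 1#
  ΨEqs-diagonal {a} {b} {x} (a≈xb , 1-a≈x[1-b]) = begin
    x                     ≈⟨ split x b ⟩
    x * b + x * (1# - b)  ≈⟨ +-cong a≈xb 1-a≈x[1-b] ⟨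
    a + (1# - a)          ≈⟨ t+[1-t]≈1 a ⟩
    1#                    ∎
    where
    split : ∀ x b → x ≈ x * b + x * (1# - b)
    split = solve 2 (λ x b → x := x :* b :+ x :* (con (+ 1) :- b)) refl

  ΨEqs⇒b[x-y]≈1-y : ΨEqs a b x y → b * (x - y) ≈ 1# - y
  ΨEqs⇒b[x-y]≈1-y {a} {b} {x} {y} (a≈xb , 1-a≈y[1-b]) = begin
    b * (x - y)                 ≈⟨ expand b x y ⟩
    (x * b + y * (1# - b)) - y  ≈⟨ +-congʳ (+-cong a≈xb 1-a≈y[1-b]) ⟨
    (a + (1# - a)) - y          ≈⟨ +-congʳ (t+[1-t]≈1 a) ⟩
    1# - y                      ∎
    where
    expand : ∀ b x y → b * (x - y) ≈ (x * b + y * (1# - b)) - y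
    expand = solve 3 (λ b x y → b :* (x :- y) := (x :* b :+ y :* (con (+ 1) :- b)) :- y) refl

  ΨEqs-intro : a ≈ x * b → b * (x - y) ≈ 1# - y → ΨEqs a b x y
  ΨEqs-intro {a} {x} {b} {y} a≈xb b[x-y]≈1-y = a≈xb , (begin
    1# - a                                   ≈⟨ +-congˡ (-‿cong a≈xb) ⟩
    1# - x * b                               ≈⟨ expand b x y ⟩
    y * (1# - b) + ((1# - y) - b * (x - y))  ≈⟨ +-congˡ (x≈y⇒x∙y⁻¹≈ε (sym b[x-y]≈1-y)) ⟩
    y * (1# - b) + 0#                        ≈⟨ +-identityʳ _ ⟩
    y * (1# - b)                             ∎)
    where
    expand : ∀ b x y → 1# - x * b ≈ y * (1# - b) + ((1# - y) - b * (x - y))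
    expand = solve 3 (λ b x y → con (+ 1) :- x :* b
                              := y :* (con (+ 1) :- b) :+ ((con (+ 1) :- y) :- b :* (x :- y))) refl

  ΨEqs⇒formulas : x ≉ y → ΨEqs a b x y →
                  (a ≈ (x * (1# - y)) / (x - y)) × (b ≈ (1# - y) / (x - y))
  ΨEqs⇒formulas {x} {y} {a} {b} x≉y e@(a≈xb , _) = a≈ , b≈
    where
    b≈ : b ≈ (1# - y) / (x - y)
    b≈ = *≈⇒≈/ (-≉0 x≉y) (ΨEqs⇒b[x-y]≈1-y e)
    a≈ : a ≈ (x * (1# - y)) / (x - y)
    a≈ = trans a≈xb (trans (*-congˡ b≈) (sym (*-assoc x _ _)))

  ΨEqs⇒FourEqs : x ≉ y → ΨEqs a b x y → FourEqs a b x y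
  ΨEqs⇒FourEqs x≉y e =
    let a≈ , b≈ = ΨEqs⇒formulas x≉y e
        1-a≈ , 1-b≈ = ΨEqs⇒formulas (≉-sym x≉y) (ΨEqs-swap e)
    in a≈ , b≈ , 1-a≈ , 1-b≈

  FourEqs⇒ΨEqs : x ≉ y → FourEqs a b x y → ΨEqs a b x y
  FourEqs⇒ΨEqs {x} x≉y (a≈ , b≈ , _) =
    ΨEqs-intro (trans a≈ (trans (*-assoc x _ _) (*-congˡ (sym b≈))))
               (≈/⇒*≈ (-≉0 x≉y) b≈)

  ΨEqs-unique : x ≉ y → ΨEqs a b x y → ΨEqs a′ b′ x y → (a ≈ a′) × (b ≈ b′)
  ΨEqs-unique x≉y e e′ =
    let a≈ , b≈ = ΨEqs⇒formulas x≉y e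
        a′≈ , b′≈ = ΨEqs⇒formulas x≉y e′
    in trans a≈ (sym a′≈) , trans b≈ (sym b′≈)

  ΨEqs⇒InΣ : InS x y → ΨEqs a b x y → InΣ a b
  ΨEqs⇒InΣ {x} {y} {a} {b} (sqx , sqy , _ , x≉0 , x≉1 , y≉0 , y≉1) e@(a≈xb , 1-a≈y[1-b]) =
    a≉b , a≉0 , a≉1 , b≉0 , b≉1 ,
    IsSquare-resp (sym (trans (*-congʳ a≈xb) (*-assoc x b b))) (IsSquare-*-square sqx) ,
    IsSquare-resp (sym (trans (*-congʳ 1-a≈y[1-b]) (*-assoc y _ _))) (IsSquare-*-square sqy)
    where
    b≉0 : b ≉ 0#
    b≉0 = factor≉0 (sym (ΨEqs⇒b[x-y]≈1-y e)) (-≉0 (≉-sym y≉1))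
    1-b≉0 : 1# - b ≉ 0#
    1-b≉0 = factor≉0 (sym (ΨEqs⇒b[x-y]≈1-y (ΨEqs-swap e))) (-≉0 (≉-sym x≉1))
    b≉1 : b ≉ 1#
    b≉1 = 1-b≉0 ∘ x≈y⇒x∙y⁻¹≈ε ∘ sym
    a≉0 : a ≉ 0#
    a≉0 = *-≉0 x≉0 b≉0 ∘ trans (sym a≈xb)
    a≉1 : a ≉ 1#
    a≉1 = *-≉0 y≉0 1-b≉0 ∘ trans (sym 1-a≈y[1-b]) ∘ x≈y⇒x∙y⁻¹≈ε ∘ sym
    a≉b : a ≉ b
    a≉b a≈b = x≉1 (trans (*≈⇒≈/ b≉0 (trans (sym a≈xb) a≈b)) (sym (*≈⇒≈/ b≉0 (*-identityˡ b))))

  Ψ-ΨEqs : InΣ a b → ΨEqs a b (a / b) ((1# - a) / (1# - b))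
  Ψ-ΨEqs σ = Equivalence.to (Ψ≈₂⇔ΨEqs σ) (refl , refl)

  Ψ-InS : InΣ a b → InS (a / b) ((1# - a) / (1# - b))
  Ψ-InS {a} {b} σ@(a≉b , a≉0 , a≉1 , b≉0 , b≉1 , sq-ab , sq-[1-a][1-b]) =
    IsSquare-/ b≉0 sq-ab , IsSquare-/ (-≉0 (≉-sym b≉1)) sq-[1-a][1-b] ,
    x≉y , x≉0 , x≉1 ,
    factor≉0 1-a≈y[1-b] (-≉0 (≉-sym a≉1)) , factor≉1 1-a≈y[1-b] (a≉b ∘ 1-‿injective)
    where
    a≈xb : a ≈ (a / b) * b
    a≈xb = Ψ-ΨEqs σ .proj₁
    1-a≈y[1-b] : 1# - a ≈ ((1# - a) / (1# - b)) * (1# - b)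
    1-a≈y[1-b] = Ψ-ΨEqs σ .proj₂
    x≉0 : a / b ≉ 0#
    x≉0 = factor≉0 a≈xb a≉0
    x≉1 : a / b ≉ 1#
    x≉1 = factor≉1 a≈xb a≉b
    x≉y : a / b ≉ (1# - a) / (1# - b)
    x≉y x≈y = x≉1 (ΨEqs-diagonal (a≈xb , trans 1-a≈y[1-b] (*-congʳ (sym x≈y))))

  Ψ-injective : InΣ a b → InΣ a′ b′ → Ψ (a , b) ≈₂ Ψ (a′ , b′) → (a , b) ≈₂ (a′ , b′)
  Ψ-injective σ σ′ (x≈x′ , y≈y′) =
    ΨEqs-unique (Ψ-InS σ .proj₂ .proj₂ .proj₁) (Ψ-ΨEqs σ)
      (Equivalence.to (Ψ≈₂⇔ΨEqs σ′) (sym x≈x′ , sym y≈y′))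

  Ψ-surjective : InS x y → ∃ λ a → ∃ λ b → InΣ a b × Ψ (a , b) ≈₂ (x , y)
  Ψ-surjective {x} {y} s@(_ , _ , x≉y , _) =
    x * b₀ , b₀ , σ , Equivalence.from (Ψ≈₂⇔ΨEqs σ) e
    where
    b₀ : Carrier
    b₀ = (1# - y) / (x - y)
    e : ΨEqs (x * b₀) b₀ x y
    e = ΨEqs-intro refl (≈/⇒*≈ (-≉0 x≉y) refl)
    σ : InΣ (x * b₀) b₀
    σ = ΨEqs⇒InΣ s e

  Ψ≈₂⇔FourEqs : InS x y → (InΣ a b × Ψ (a , b) ≈₂ (x , y)) ⇔ FourEqs a b x y
  Ψ≈₂⇔FourEqs s@(_ , _ , x≉y , _) = mk⇔
    (λ (σ , Ψ≈) → ΨEqs⇒FourEqs x≉y (Equivalence.to (Ψ≈₂⇔ΨEqs σ) Ψ≈))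
    (λ eqs → let e = FourEqs⇒ΨEqs x≉y eqs
                 σ = ΨEqs⇒InΣ s e
             in σ , Equivalence.from (Ψ≈₂⇔ΨEqs σ) e)

  FourEqs-unique-solution : InΣ a b →
    ∃ λ x → ∃ λ y → InS x y × FourEqs a b x y
      × (∀ x′ y′ → InS x′ y′ → FourEqs a b x′ y′ → (x′ ≈ x) × (y′ ≈ y))
  FourEqs-unique-solution {a} {b} σ =
    _ , _ , s , ΨEqs⇒FourEqs (s .proj₂ .proj₂ .proj₁) (Ψ-ΨEqs σ) , unique
    where
    s : InS (a / b) ((1# - a) / (1# - b))
    s = Ψ-InS σ
    unique : ∀ x′ y′ → InS x′ y′ → FourEqs a b x′ y′ →
             (x′ ≈ a / b) × (y′ ≈ (1# - a) / (1# - b))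
    unique x′ y′ s′ eqs =
      let _ , x≈x′ , y≈y′ = Equivalence.from (Ψ≈₂⇔FourEqs s′) eqs in sym x≈x′ , sym y≈y′

proposition1p2 : {c ℓ : Level} (F : FiniteField c ℓ) → OddPrimePower (FiniteField.size F) →
    let open FiniteField F in
    -- (i) for each (a,b) ∈ Σ there is exactly one (x,y) ∈ S with the four equalities
    (∀ a b → InΣ a b →
      ∃ λ x → ∃ λ y → InS x y × FourEqs a b x y
        × (∀ x′ y′ → InS x′ y′ → FourEqs a b x′ y′ → (x′ ≈ x) × (y′ ≈ y)))
    -- (ii) Ψ : Σ → S is well defined, injective and surjective (a bijection)
    × (∀ a b → InΣ a b → InS (a / b) ((1# - a) / (1# - b)))
    × (∀ a b a′ b′ → InΣ a b → InΣ a′ b′ → Ψ (a , b) ≈₂ Ψ (a′ , b′) → (a , b) ≈₂ (a′ , b′))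
    × (∀ x y → InS x y → ∃ λ a → ∃ λ b → InΣ a b × Ψ (a , b) ≈₂ (x , y))
    -- (iii) for (x,y) ∈ S and any a, b: Ψ⁻¹ (x,y) = (a,b) (i.e. (a,b) ∈ Σ and Ψ (a,b) = (x,y))
    --       iff the four equalities hold
    × (∀ x y a b → InS x y → ((InΣ a b × Ψ (a , b) ≈₂ (x , y)) ⇔ FourEqs a b x y))
proposition1p2 F _ =
  (λ _ _ → FourEqs-unique-solution F) ,
  (λ _ _ → Ψ-InS F) ,
  (λ _ _ _ _ → Ψ-injective F) ,
  (λ _ _ → Ψ-surjective F) ,
  (λ _ _ _ _ → Ψ≈₂⇔FourEqs F)
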